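{- For integers $m,n\ge1$, the $2$-shunt intersection graph $A_2(S_{m,n})$ of the bistar $S_{m,n}$ is a complete graph on $m+n$ vertices.
   Context: The bistar $S_{m,n}$ is obtained from the stars $K_{1,m}$ and $K_{1,n}$ by joining their centres with an edge. A $2$-arc on distinct vertices is a sequence $(x,u,y)$ of pairwise distinct vertices with $xu,uy\in E(G)$; it can be shunted onto $(u,y,z)$ if $x,u,y,z$ are pairwise distinct and $yz\in E(G)$. $A_2(G)$ has as vertices the $2$-arcs on distinct vertices that can be shunted onto some other $2$-arc on distinct vertices; two distinct vertices are adjacent iff the corresponding $2$-arcs share at least one vertex of $G$. -}

module Defs where

open import Data.Nat using (ℕ)
open import Data.Fin using (Fin)
open import Data.Product using (Σ; _×_; _,_)
open import Data.Sum using (_⊎_)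
open import Data.List using (List; length)
open import Data.List.Membership.Propositional using (_∈_)
open import Data.List.Relation.Unary.Unique.Propositional using (Unique)
open import Relation.Binary.PropositionalEquality using (_≡_; _≢_)

record Graph : Set₁ where
  field
    V : Set
    E : V → V → Set

open Graph public

Triple : Graph → Set
Triple G = V G × V G × V G

IsTwoArc : (G : Graph) → Triple G → Set
IsTwoArc G (x , u , y) = x ≢ u × u ≢ y × x ≢ y × E G x u × E G u y

ShuntsOnto : (G : Graph) → Triple G → V G → Set
ShuntsOnto G (x , u , y) z =
  x ≢ u × x ≢ y × x ≢ z × u ≢ y × u ≢ z × y ≢ z × E G y z

A₂Vertex : (G : Graph) → Triple G → Set
A₂Vertex G t@(x , u , y) =
  IsTwoArc G t × Σ (V G) (λ z → ShuntsOnto G t z × IsTwoArc G (u , y , z))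

_occursIn_ : {G : Graph} → V G → Triple G → Set
v occursIn (x , u , y) = v ≡ x ⊎ v ≡ u ⊎ v ≡ y

A₂Adj : (G : Graph) → Triple G → Triple G → Set
A₂Adj G s t = s ≢ t × Σ (V G) (λ v → _occursIn_ {G} v s × _occursIn_ {G} v t)

IsCompleteOn : {A : Set} → ℕ → (A → Set) → (A → A → Set) → Set
IsCompleteOn {A} k P Adj =
  Σ (List A) λ L →
    length L ≡ k × Unique L ×
    (∀ t → P t → t ∈ L) × (∀ t → t ∈ L → P t) ×
    (∀ s t → P s → P t → s ≢ t → Adj s t)

-- Vertices of the bistar S_{m,n}: centres a, b; leaves of a, leaves of b.
data BVert (m n : ℕ) : Set where
  ca cb : BVert m n
  la    : Fin m → BVert m n
  lb    : Fin n → BVert m n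

data BEdge {m n : ℕ} : BVert m n → BVert m n → Set where
  ab  : BEdge ca cb
  ba  : BEdge cb ca
  a-l : (i : Fin m) → BEdge ca (la i)
  l-a : (i : Fin m) → BEdge (la i) ca
  b-l : (j : Fin n) → BEdge cb (lb j)
  l-b : (j : Fin n) → BEdge (lb j) cb

Bistar : ℕ → ℕ → Graph
Bistar m n = record { V = BVert m n ; E = BEdge }

-- In S_{m,n} with centres a, b, a 2-arc on distinct vertices either has a
-- centre as an end, and then it cannot be continued, or it runs from a leaf
-- through both centres.  So the vertices of A₂(S_{m,n}) are exactly the m arcs
-- (ℓ, a, b) and the n arcs (ℓ, b, a); every one of them passes through a, so
-- any two of them intersect.
module Submission where

open import Defs
open import Data.Nat using (ℕ; _≤_; _+_; s≤s)
open import Data.Fin using (Fin; zero)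
open import Data.Product using (∃; _×_; _,_)
open import Data.Sum using (_⊎_; inj₁; inj₂)
open import Data.Empty using (⊥; ⊥-elim)
open import Data.List using (List; length; tabulate; _++_)
open import Data.List.Properties using (length-++; length-tabulate)
open import Data.List.Membership.Propositional using (_∈_)
open import Data.List.Membership.Propositional.Properties
  using (∈-tabulate⁺; ∈-tabulate⁻; ∈-++⁺ˡ; ∈-++⁺ʳ; ∈-++⁻)
open import Data.List.Relation.Unary.Unique.Propositional using (Unique)
open import Data.List.Relation.Unary.Unique.Propositional.Properties using (++⁺; tabulate⁺)
open import Relation.Binary.PropositionalEquality using (_≡_; refl; trans; cong₂)

A₂Adj-complete-of-common-vertex :
  (G : Graph) {k : ℕ} (L : List (Triple G)) (v : V G) →
  length L ≡ k → Unique L →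
  (∀ t → A₂Vertex G t → t ∈ L) → (∀ t → t ∈ L → A₂Vertex G t) →
  (∀ t → t ∈ L → _occursIn_ {G} v t) →
  IsCompleteOn k (A₂Vertex G) (A₂Adj G)
A₂Adj-complete-of-common-vertex G L v length-L unique-L sound complete common =
  L , length-L , unique-L , sound , complete ,
  λ s t s∈ t∈ s≢t → s≢t , v , common s (sound s s∈) , common t (sound t t∈)

module _ (m n : ℕ) where

  private
    G : Graph
    G = Bistar m n

  arcViaA : Fin m → Triple G
  arcViaA i = la i , ca , cb

  arcViaB : Fin n → Triple G
  arcViaB j = lb j , cb , ca

  shuntableArcs : List (Triple G)
  shuntableArcs = tabulate arcViaA ++ tabulate arcViaB

  ∈-shuntableArcs⁻ : ∀ {t} → t ∈ shuntableArcs →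
    (∃ λ i → t ≡ arcViaA i) ⊎ (∃ λ j → t ≡ arcViaB j)
  ∈-shuntableArcs⁻ t∈ with ∈-++⁻ (tabulate arcViaA) t∈
  ... | inj₁ t∈A = inj₁ (∈-tabulate⁻ t∈A)
  ... | inj₂ t∈B = inj₂ (∈-tabulate⁻ t∈B)

  length-shuntableArcs : length shuntableArcs ≡ m + n
  length-shuntableArcs =
    trans (length-++ (tabulate arcViaA))
          (cong₂ _+_ (length-tabulate arcViaA) (length-tabulate arcViaB))

  unique-shuntableArcs : Unique shuntableArcs
  unique-shuntableArcs =
    ++⁺ (tabulate⁺ arcViaA-injective) (tabulate⁺ arcViaB-injective) arcViaA≢arcViaB
    where
    arcViaA-injective : ∀ {i i′} → arcViaA i ≡ arcViaA i′ → i ≡ i′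
    arcViaA-injective refl = refl

    arcViaB-injective : ∀ {j j′} → arcViaB j ≡ arcViaB j′ → j ≡ j′
    arcViaB-injective refl = refl

    arcViaA≢arcViaB : ∀ {t} → t ∈ tabulate arcViaA × t ∈ tabulate arcViaB → ⊥
    arcViaA≢arcViaB (t∈A , t∈B) with ∈-tabulate⁻ {f = arcViaA} t∈A | ∈-tabulate⁻ {f = arcViaB} t∈B
    ... | i , refl | j , ()

  -- Any other 2-arc either repeats a vertex or ends in a leaf, whose only
  -- neighbour is the middle vertex of the arc, so it cannot be shunted.
  A₂Vertex⇒∈-shuntableArcs : ∀ t → A₂Vertex G t → t ∈ shuntableArcs
  A₂Vertex⇒∈-shuntableArcs _ ((_ , _ , x≢y , ab , ba) , _) = ⊥-elim (x≢y refl)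
  A₂Vertex⇒∈-shuntableArcs _ ((_ , _ , _ , ab , b-l j) , _ , (_ , _ , _ , _ , u≢z , _ , l-b .j) , _) = ⊥-elim (u≢z refl)
  A₂Vertex⇒∈-shuntableArcs _ ((_ , _ , x≢y , ba , ab) , _) = ⊥-elim (x≢y refl)
  A₂Vertex⇒∈-shuntableArcs _ ((_ , _ , _ , ba , a-l i) , _ , (_ , _ , _ , _ , u≢z , _ , l-a .i) , _) = ⊥-elim (u≢z refl)
  A₂Vertex⇒∈-shuntableArcs _ ((_ , _ , x≢y , a-l i , l-a .i) , _) = ⊥-elim (x≢y refl)
  A₂Vertex⇒∈-shuntableArcs _ ((_ , _ , _ , l-a i , ab) , _ , (_ , _ , _ , _ , _ , _ , b-l _) , _) = ∈-++⁺ˡ (∈-tabulate⁺ i)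
  A₂Vertex⇒∈-shuntableArcs _ ((_ , _ , _ , l-a i , ab) , _ , (_ , _ , _ , _ , u≢z , _ , ba) , _) = ⊥-elim (u≢z refl)
  A₂Vertex⇒∈-shuntableArcs _ ((_ , _ , _ , l-a _ , a-l i) , _ , (_ , _ , _ , _ , u≢z , _ , l-a .i) , _) = ⊥-elim (u≢z refl)
  A₂Vertex⇒∈-shuntableArcs _ ((_ , _ , x≢y , b-l j , l-b .j) , _) = ⊥-elim (x≢y refl)
  A₂Vertex⇒∈-shuntableArcs _ ((_ , _ , _ , l-b j , ba) , _ , (_ , _ , _ , _ , _ , _ , a-l _) , _) = ∈-++⁺ʳ (tabulate arcViaA) (∈-tabulate⁺ j)
  A₂Vertex⇒∈-shuntableArcs _ ((_ , _ , _ , l-b j , ba) , _ , (_ , _ , _ , _ , u≢z , _ , ab) , _) = ⊥-elim (u≢z refl)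
  A₂Vertex⇒∈-shuntableArcs _ ((_ , _ , _ , l-b _ , b-l j) , _ , (_ , _ , _ , _ , u≢z , _ , l-b .j) , _) = ⊥-elim (u≢z refl)

  -- (ℓ, a, b) is shunted onto (a, b, ℓ′) for a leaf ℓ′ of b, which exists since n ≥ 1.
  arcViaA-A₂Vertex : 1 ≤ n → ∀ i → A₂Vertex G (arcViaA i)
  arcViaA-A₂Vertex (s≤s _) i =
    ((λ ()) , (λ ()) , (λ ()) , l-a i , ab) , lb zero ,
    ((λ ()) , (λ ()) , (λ ()) , (λ ()) , (λ ()) , (λ ()) , b-l zero) ,
    ((λ ()) , (λ ()) , (λ ()) , ab , b-l zero)

  arcViaB-A₂Vertex : 1 ≤ m → ∀ j → A₂Vertex G (arcViaB j)
  arcViaB-A₂Vertex (s≤s _) j =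
    ((λ ()) , (λ ()) , (λ ()) , l-b j , ba) , la zero ,
    ((λ ()) , (λ ()) , (λ ()) , (λ ()) , (λ ()) , (λ ()) , a-l zero) ,
    ((λ ()) , (λ ()) , (λ ()) , ba , a-l zero)

  ∈-shuntableArcs⇒A₂Vertex : 1 ≤ m → 1 ≤ n → ∀ t → t ∈ shuntableArcs → A₂Vertex G t
  ∈-shuntableArcs⇒A₂Vertex 1≤m 1≤n t t∈ with ∈-shuntableArcs⁻ t∈
  ... | inj₁ (i , refl) = arcViaA-A₂Vertex 1≤n i
  ... | inj₂ (j , refl) = arcViaB-A₂Vertex 1≤m j

  ca-occursIn-shuntableArcs : ∀ t → t ∈ shuntableArcs → _occursIn_ {G} ca t
  ca-occursIn-shuntableArcs t t∈ with ∈-shuntableArcs⁻ t∈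
  ... | inj₁ (_ , refl) = inj₂ (inj₁ refl)
  ... | inj₂ (_ , refl) = inj₂ (inj₂ refl)

mainTheorem13 : (m n : ℕ) → 1 ≤ m → 1 ≤ n →
    IsCompleteOn (m + n) (A₂Vertex (Bistar m n)) (A₂Adj (Bistar m n))
mainTheorem13 m n 1≤m 1≤n =
  A₂Adj-complete-of-common-vertex (Bistar m n) (shuntableArcs m n) ca
    (length-shuntableArcs m n) (unique-shuntableArcs m n)
    (A₂Vertex⇒∈-shuntableArcs m n) (∈-shuntableArcs⇒A₂Vertex m n 1≤m 1≤n)
    (ca-occursIn-shuntableArcs m n)
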